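{- For every primed word $w$, $\mathsf{unprime}(P_{\mathsf{dec}}(w))=P_{\mathsf{dec}}(\mathsf{unprime}(w))$ and $\mathsf{unprime}(Q_{\mathsf{dec}}(w))=Q_{\mathsf{dec}}(\mathsf{unprime}(w))$.
   Context: Primed numbers: $i':=i-\tfrac12$, ordered $1'<1<2'<2<\cdots$; $\lceil\cdot\rceil$ removes a prime; $\mathsf{unprime}$ removes all primes from a word or tableau. For strict $\lambda$ the shifted diagram is $\{(i,i+j-1):i\in[\ell(\lambda)],j\in[\lambda_i]\}$; row $i$ = boxes $(i,\cdot)$. A hook word is a sequence of positive integers $w_1\cdots w_k$ with $w_1\ge\dots\ge w_p<w_{p+1}<\dots<w_k$ for some $p\in[k]$; $w_1\cdots w_p$ is its weakly decreasing part, $w_{p+1}\cdots w_k$ its increasing part, $w_p$ its middle element. A decomposition tableau assigns positive integers so that each row $\rho_i$ (left to right) is a hook word and $\rho_i$ is a hook subword of maximal length in $\rho_{i+1}\rho_i$; a primed decomposition tableau adds primes to the middle elements of some subset of rows. Decomposition insertion $x\xrightarrow{\mathsf{dec}}T$: at step $i$ a primed number $a_i$ is inserted into row $i$ (possibly empty), starting with $a_1=x$. Put $a=\lceil a_i\rceil$ and remove any prime from the middle element $m_i$ of row $i$ (if nonempty), remembering whether it was primed. If appending $a$ to the row gives a hook word, append it; otherwise $a$ replaces the leftmost entry $b$ of the increasing part with $b\ge a$, and $b$ replaces the leftmost entry $c$ of the weakly decreasing part with $c<b$. Then (1) if row $i$ was empty or the middle position changed: if $a_i$ is primed, prime the new middle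 element; if a box was appended, halt, the insertion being even if row $i$ was empty or $m_i$ unprimed, odd otherwise; else $a_{i+1}=c$ if $m_i$ was unprimed, $c'$ if primed. (2) Otherwise: if $m_i$ was primed, prime the middle element; if a box was appended, halt, the insertion being even if $a_i$ is unprimed, odd if primed; else $a_{i+1}=c$ if $a_i$ is unprimed, $c'$ if primed. For $w=w_m\cdots w_2w_1$, $P_{\mathsf{dec}}(w):=w_m\xrightarrow{\mathsf{dec}}(\cdots(w_1\xrightarrow{\mathsf{dec}}\emptyset)\cdots)$ and $Q_{\mathsf{dec}}(w)$ has $i$ (resp. $i'$) in the box added when inserting $w_i$ if that insertion is even (resp. odd). -}

module Defs where

open import Data.Nat using (ℕ; zero; suc; _≤ᵇ_; _<ᵇ_; _≡ᵇ_; _≤_)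
open import Data.Bool using (Bool; true; false; if_then_else_; _∧_; not; _∨_)
open import Data.List using (List; []; _∷_; _++_; [_]; take; drop; length; map)
open import Data.Maybe using (Maybe; just; nothing)
open import Data.Product using (_×_; _,_; proj₁; proj₂)

-- A primed number: value v with flag p; (v , false) is v, (v , true) is v'
-- (i.e. v - 1/2).  ⌈·⌉ is `val`.
record Primed : Set where
  constructor pn
  field
    val : ℕ
    prm : Bool
open Primed public

-- A primed word; as a list it is  w_m ⋯ w_2 w_1  (w_1 is the last element).
Word : Set
Word = List Primed

decLen : List ℕ → ℕ
decLen [] = 0
decLen (x ∷ []) = 1
decLen (x ∷ y ∷ ys) = if y ≤ᵇ x then suc (decLen (y ∷ ys)) else 1

incStrict : List ℕ → Bool
incStrict [] = true
incStrict (x ∷ []) = true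
incStrict (x ∷ y ∷ ys) = (x <ᵇ y) ∧ incStrict (y ∷ ys)

-- w is a (nonempty) hook word iff what follows its maximal weakly
-- decreasing prefix is strictly increasing; the middle element is then
-- the entry at position decLen w.
isHook : List ℕ → Bool
isHook [] = false
isHook (x ∷ xs) = incStrict (drop (decLen (x ∷ xs)) (x ∷ xs))

replaceFirst : (ℕ → Bool) → ℕ → List ℕ → Maybe (List ℕ × ℕ)
replaceFirst q new [] = nothing
replaceFirst q new (x ∷ xs) with q x
... | true = just (new ∷ xs , x)
... | false with replaceFirst q new xs
...   | nothing = nothing
...   | just (ys , y) = just (x ∷ ys , y)

bump : ℕ → List ℕ → Maybe (List ℕ × ℕ)
bump a w with replaceFirst (λ b → a ≤ᵇ b) a (drop (decLen w) w)
... | nothing = nothing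
... | just (I' , b) with replaceFirst (λ c → c <ᵇ b) b (take (decLen w) w)
...   | nothing = nothing
...   | just (D' , c) = just (D' ++ I' , c)

-- Primed decomposition tableaux: a list of rows (row 1 first, shifted
-- shape implicit); each row is its word of unprimed entries together
-- with a flag saying whether its middle element is primed.

Row : Set
Row = List ℕ × Bool

PTab : Set
PTab = List Row

QTab : Set
QTab = List (List Primed)

-- Result of x →dec T: new tableau, index (0-based) of the row in which a
-- box was added, and whether the insertion is odd.
insertDec : Primed → PTab → PTab × ℕ × Bool
insertDec x [] = (([ val x ] , prm x) ∷ []) , 0 , false
insertDec x (([] , mP) ∷ rs) = (([ val x ] , prm x) ∷ rs) , 0 , false
insertDec x ((w@(_ ∷ _) , mP) ∷ rs) with isHook (w ++ [ val x ])
... | true =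
  if not (decLen w ≡ᵇ decLen (w ++ [ val x ]))
  then (((w ++ [ val x ]) , prm x) ∷ rs) , 0 , mP
  else (((w ++ [ val x ]) , mP) ∷ rs) , 0 , prm x
... | false with bump (val x) w
...   | nothing = (((w ++ [ val x ]) , mP) ∷ rs) , 0 , false  -- unreachable
...   | just (w' , c) with not (decLen w ≡ᵇ decLen w')
...     | true with insertDec (pn c mP) rs
...       | (T , j , odd) = ((w' , prm x) ∷ T) , suc j , odd
insertDec x ((w@(_ ∷ _) , mP) ∷ rs) | false | just (w' , c) | false
  with insertDec (pn c (prm x)) rs
... | (T , j , odd) = ((w' , mP) ∷ T) , suc j , odd

addAt : ℕ → Primed → QTab → QTab
addAt zero e [] = [ e ] ∷ []
addAt zero e (r ∷ rs) = (r ++ [ e ]) ∷ rs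
addAt (suc j) e [] = [ e ] ∷ []   -- unreachable
addAt (suc j) e (r ∷ rs) = r ∷ addAt j e rs

-- (P_dec(w), Q_dec(w)) for w = w_m ⋯ w_1: w_1 is inserted first;
-- the head of (x ∷ xs) is w_{length xs + 1}.
decRS : Word → PTab × QTab
decRS [] = [] , []
decRS (x ∷ xs) with decRS xs
... | (P , Q) with insertDec x P
...   | (P' , j , odd) = P' , addAt j (pn (suc (length xs)) odd) Q

Pdec : Word → PTab
Pdec w = proj₁ (decRS w)

Qdec : Word → QTab
Qdec w = proj₂ (decRS w)

unprimeNum : Primed → Primed
unprimeNum x = pn (val x) false

unprimeWord : Word → Word
unprimeWord = map unprimeNum

unprimeP : PTab → PTab
unprimeP = map (λ r → proj₁ r , false)

unprimeQ : QTab → QTab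
unprimeQ = map (map unprimeNum)

{-# OPTIONS --safe #-}
module Submission where

-- The prime flags never influence the unprimed data of decomposition
-- insertion: which entries move, and into which row a box is added, are
-- decided by comparisons of unprimed values alone.  Hence P_dec(w) and
-- P_dec(unprime w) have the same row words, and Q_dec(w) and
-- Q_dec(unprime w) have their boxes in the same places.  Moreover, inserting
-- unprimed letters into a tableau without primes never creates a prime and
-- is always even, so P_dec(unprime w) and Q_dec(unprime w) carry no primes
-- at all.

open import Defs
open import Data.Nat using (_≤_; ℕ; zero; suc; _≡ᵇ_)
open import Data.Bool using (Bool; true; false; not)
open import Data.List using (List; []; _∷_; _++_; [_]; map; length)
open import Data.List.Properties using (map-++; map-∘; length-map)
open import Data.List.Relation.Unary.All using (All; []; _∷_)
open import Data.Maybe using (just; nothing)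
open import Data.Product using (_×_; _,_; proj₁; proj₂)
open import Relation.Binary.PropositionalEquality
  using (_≡_; refl; cong; cong₂; sym; module ≡-Reasoning)

rows : PTab → List (List ℕ)
rows = map proj₁

Unprimed : PTab → Set
Unprimed = All (λ r → proj₂ r ≡ false)

-- insertDec with all prime flags forgotten.
rowInsert : ℕ → List (List ℕ) → List (List ℕ) × ℕ
rowInsert v [] = ([ v ] ∷ []) , 0
rowInsert v ([] ∷ ws) = ([ v ] ∷ ws) , 0
rowInsert v (w@(_ ∷ _) ∷ ws) with isHook (w ++ [ v ])
... | true = ((w ++ [ v ]) ∷ ws) , 0
... | false with bump v w
...   | nothing = ((w ++ [ v ]) ∷ ws) , 0
...   | just (w' , c) = (w' ∷ proj₁ (rowInsert c ws)) , suc (proj₂ (rowInsert c ws))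

rowsAndRow : PTab × ℕ × Bool → List (List ℕ) × ℕ
rowsAndRow (T , j , _) = rows T , j

rowsAndRow-insertDec : ∀ x P → rowsAndRow (insertDec x P) ≡ rowInsert (val x) (rows P)
rowsAndRow-insertDec x [] = refl
rowsAndRow-insertDec x (([] , _) ∷ rs) = refl
rowsAndRow-insertDec x ((w@(_ ∷ _) , mP) ∷ rs) with isHook (w ++ [ val x ])
... | true with not (decLen w ≡ᵇ decLen (w ++ [ val x ]))
...   | true = refl
...   | false = refl
rowsAndRow-insertDec x ((w@(_ ∷ _) , mP) ∷ rs) | false with bump (val x) w
...   | nothing = refl
...   | just (w' , c) with not (decLen w ≡ᵇ decLen w')
...     | true = cong (λ p → (w' ∷ proj₁ p) , suc (proj₂ p)) (rowsAndRow-insertDec (pn c mP) rs)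
...     | false = cong (λ p → (w' ∷ proj₁ p) , suc (proj₂ p)) (rowsAndRow-insertDec (pn c (prm x)) rs)

insertDec-unprimed : ∀ v P → Unprimed P →
  Unprimed (proj₁ (insertDec (pn v false) P)) × proj₂ (proj₂ (insertDec (pn v false) P)) ≡ false
insertDec-unprimed v [] _ = (refl ∷ []) , refl
insertDec-unprimed v (([] , _) ∷ rs) (_ ∷ rs-unprimed) = (refl ∷ rs-unprimed) , refl
insertDec-unprimed v ((w@(_ ∷ _) , .false) ∷ rs) (refl ∷ rs-unprimed) with isHook (w ++ [ v ])
... | true with not (decLen w ≡ᵇ decLen (w ++ [ v ]))
...   | true = (refl ∷ rs-unprimed) , refl
...   | false = (refl ∷ rs-unprimed) , refl
insertDec-unprimed v ((w@(_ ∷ _) , .false) ∷ rs) (refl ∷ rs-unprimed) | false with bump v w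
...   | nothing = (refl ∷ rs-unprimed) , refl
...   | just (w' , c) with not (decLen w ≡ᵇ decLen w')
...     | true = let (T-unprimed , even) = insertDec-unprimed c rs rs-unprimed in (refl ∷ T-unprimed) , even
...     | false = let (T-unprimed , even) = insertDec-unprimed c rs rs-unprimed in (refl ∷ T-unprimed) , even

unprimeP-rows : ∀ P → unprimeP P ≡ map (_, false) (rows P)
unprimeP-rows = map-∘

unprimeP-unprimed : ∀ P → Unprimed P → unprimeP P ≡ P
unprimeP-unprimed [] [] = refl
unprimeP-unprimed ((w , .false) ∷ P) (refl ∷ P-unprimed) = cong (_ ∷_) (unprimeP-unprimed P P-unprimed)

unprimeQ-addAt : ∀ j e Q → unprimeQ (addAt j e Q) ≡ addAt j (unprimeNum e) (unprimeQ Q)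
unprimeQ-addAt zero e [] = refl
unprimeQ-addAt zero e (r ∷ Q) = cong (_∷ _) (map-++ unprimeNum r [ e ])
unprimeQ-addAt (suc j) e [] = refl
unprimeQ-addAt (suc j) e (r ∷ Q) = cong (_ ∷_) (unprimeQ-addAt j e Q)

Pdec-unprimeWord-unprimed : ∀ w → Unprimed (Pdec (unprimeWord w))
Pdec-unprimeWord-unprimed [] = []
Pdec-unprimeWord-unprimed (x ∷ xs) =
  proj₁ (insertDec-unprimed (val x) (Pdec (unprimeWord xs)) (Pdec-unprimeWord-unprimed xs))

insertDec-unprimeWord-even : ∀ x xs →
  proj₂ (proj₂ (insertDec (unprimeNum x) (Pdec (unprimeWord xs)))) ≡ false
insertDec-unprimeWord-even x xs =
  proj₂ (insertDec-unprimed (val x) (Pdec (unprimeWord xs)) (Pdec-unprimeWord-unprimed xs))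

rowsAndRow-insertDec-unprimeWord : ∀ x xs → rows (Pdec xs) ≡ rows (Pdec (unprimeWord xs)) →
  rowsAndRow (insertDec x (Pdec xs)) ≡ rowsAndRow (insertDec (unprimeNum x) (Pdec (unprimeWord xs)))
rowsAndRow-insertDec-unprimeWord x xs same-rows = begin
  rowsAndRow (insertDec x (Pdec xs))               ≡⟨ rowsAndRow-insertDec x (Pdec xs) ⟩
  rowInsert (val x) (rows (Pdec xs))               ≡⟨ cong (rowInsert (val x)) same-rows ⟩
  rowInsert (val x) (rows (Pdec (unprimeWord xs))) ≡⟨ sym (rowsAndRow-insertDec (unprimeNum x) P₀) ⟩
  rowsAndRow (insertDec (unprimeNum x) P₀)         ∎
  where
  open ≡-Reasoning
  P₀ : PTab
  P₀ = Pdec (unprimeWord xs)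

rows-Pdec-unprimeWord : ∀ w → rows (Pdec w) ≡ rows (Pdec (unprimeWord w))
rows-Pdec-unprimeWord [] = refl
rows-Pdec-unprimeWord (x ∷ xs) =
  cong proj₁ (rowsAndRow-insertDec-unprimeWord x xs (rows-Pdec-unprimeWord xs))

unprimeQ-Qdec : ∀ w → unprimeQ (Qdec w) ≡ Qdec (unprimeWord w)
unprimeQ-Qdec [] = refl
unprimeQ-Qdec (x ∷ xs) = begin
  unprimeQ (addAt j (pn (suc (length xs)) odd) (Qdec xs))
    ≡⟨ unprimeQ-addAt j _ (Qdec xs) ⟩
  addAt j (pn (suc (length xs)) false) (unprimeQ (Qdec xs))
    ≡⟨ cong₂ (λ i Q → addAt i (pn (suc (length xs)) false) Q) same-row (unprimeQ-Qdec xs) ⟩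
  addAt j₀ (pn (suc (length xs)) false) (Qdec (unprimeWord xs))
    ≡⟨ cong₂ (λ n o → addAt j₀ (pn (suc n) o) (Qdec (unprimeWord xs)))
             (sym (length-map unprimeNum xs)) (sym (insertDec-unprimeWord-even x xs)) ⟩
  addAt j₀ (pn (suc (length (unprimeWord xs))) odd₀) (Qdec (unprimeWord xs)) ∎
  where
  open ≡-Reasoning
  j j₀ : ℕ
  odd odd₀ : Bool
  j = proj₁ (proj₂ (insertDec x (Pdec xs)))
  odd = proj₂ (proj₂ (insertDec x (Pdec xs)))
  j₀ = proj₁ (proj₂ (insertDec (unprimeNum x) (Pdec (unprimeWord xs))))
  odd₀ = proj₂ (proj₂ (insertDec (unprimeNum x) (Pdec (unprimeWord xs))))
  same-row : j ≡ j₀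
  same-row = cong proj₂ (rowsAndRow-insertDec-unprimeWord x xs (rows-Pdec-unprimeWord xs))

unprimeP-Pdec : ∀ w → unprimeP (Pdec w) ≡ Pdec (unprimeWord w)
unprimeP-Pdec w = begin
  unprimeP (Pdec w)                            ≡⟨ unprimeP-rows (Pdec w) ⟩
  map (_, false) (rows (Pdec w))               ≡⟨ cong (map (_, false)) (rows-Pdec-unprimeWord w) ⟩
  map (_, false) (rows (Pdec (unprimeWord w))) ≡⟨ sym (unprimeP-rows _) ⟩
  unprimeP (Pdec (unprimeWord w))              ≡⟨ unprimeP-unprimed _ (Pdec-unprimeWord-unprimed w) ⟩
  Pdec (unprimeWord w)                         ∎
  where open ≡-Reasoning

mainTheorem11 : (w : Word) → All (λ x → 1 ≤ val x) w →
    (unprimeP (Pdec w) ≡ Pdec (unprimeWord w)) × (unprimeQ (Qdec w) ≡ Qdec (unprimeWord w))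
mainTheorem11 w _ = unprimeP-Pdec w , unprimeQ-Qdec w
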